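{- Let $\Gamma$ be a finite simple graph and let $\tilde\Gamma$ be the prime graph of $SEP(\Gamma)$. (1) If $\Gamma$ has exactly one structural equivalence class, of size $\alpha$, then $V(\tilde\Gamma)$ is the set of primes $\le\alpha$, and for distinct primes $p,q\in V(\tilde\Gamma)$, $pq\in E(\tilde\Gamma)$ if and only if $p+q\le\alpha$. (2) If $\Gamma$ has at least two structural equivalence classes, with $\alpha$ the size of a largest class and $\beta$ the size of a second largest class (i.e. the largest size among the remaining classes after removing one largest class), then $V(\tilde\Gamma)$ is the set of primes $\le\alpha$, and for primes $p>q$ in $V(\tilde\Gamma)$, $pq\in E(\tilde\Gamma)$ if and only if $p+q\le\alpha$, or $p\le\alpha$ and $q\le\beta$.
   Context: Two vertices $u,v$ of a graph $\Gamma$ are structurally equivalent if the transposition $(u\,v)$ (swapping $u,v$, fixing other vertices) is an automorphism of $\Gamma$; this is an equivalence relation whose classes are the structural equivalence classes. $SEP(\Gamma)=\langle\{(u\,v) : (u\,v)\in \mathrm{Aut}(\Gamma)\}\rangle$. The prime graph of a finite group $G$ is the graph whose vertices are the primes dividing $|G|$, with distinct primes $p,q$ adjacent iff $G$ contains an element of order $pq$. -}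

module Defs where

open import Data.Nat using (ℕ; zero; suc; _<_; _≤_; _+_; _*_)
open import Data.Nat.Divisibility using (_∣_)
open import Data.Nat.Primality using (Prime)
open import Data.Bool using (Bool; true; false; if_then_else_)
open import Data.Bool.Properties using () renaming (_≟_ to _≟ᵇ_)
open import Data.Fin using (Fin)
open import Data.Fin.Properties using (all?) renaming (_≟_ to _≟ᶠ_)
open import Data.List using (List; []; _∷_; length; filter)
open import Data.List.Relation.Unary.All using (All)
open import Data.Product using (Σ; _×_; _,_; ∃)
open import Relation.Nullary using (¬_; Dec; does)
open import Relation.Binary.PropositionalEquality using (_≡_; _≢_; _≗_)
open import Function using (id; _∘_)
open import Data.List using (allFin)

record Graph (n : ℕ) : Set where
  field
    adj     : Fin n → Fin n → Bool
    adj-sym : ∀ i j → adj i j ≡ adj j i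
    adj-irr : ∀ i → adj i i ≡ false
open Graph public

swap : ∀ {n} → Fin n → Fin n → Fin n → Fin n
swap u v i = if does (i ≟ᶠ u) then v else (if does (i ≟ᶠ v) then u else i)

IsAut : ∀ {n} → Graph n → (Fin n → Fin n) → Set
IsAut Γ σ = ∀ i j → adj Γ (σ i) (σ j) ≡ adj Γ i j

StrEq : ∀ {n} → Graph n → Fin n → Fin n → Set
StrEq Γ u v = IsAut Γ (swap u v)

strEq? : ∀ {n} (Γ : Graph n) u v → Dec (StrEq Γ u v)
strEq? Γ u v = all? (λ i → all? (λ j → adj Γ (swap u v i) (swap u v j) ≟ᵇ adj Γ i j))

classSize : ∀ {n} → Graph n → Fin n → ℕ
classSize {n} Γ u = length (filter (strEq? Γ u) (allFin n))

prodSwaps : ∀ {n} → List (Fin n × Fin n) → Fin n → Fin n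
prodSwaps []             = id
prodSwaps ((u , v) ∷ ts) = swap u v ∘ prodSwaps ts

-- Membership in SEP(Γ) = ⟨ (u v) : (u v) ∈ Aut Γ ⟩ ≤ Sym(Fin n).
-- Since the generators are involutions, the generated subgroup is the
-- set of finite products of generators (empty product = identity).
InSEP : ∀ {n} → Graph n → (Fin n → Fin n) → Set
InSEP {n} Γ σ = Σ (List (Fin n × Fin n)) λ ts →
  All (λ uv → StrEq Γ (Data.Product.proj₁ uv) (Data.Product.proj₂ uv)) ts × (σ ≗ prodSwaps ts)

SEPOrder : ∀ {n} → Graph n → ℕ → Set
SEPOrder {n} Γ m = Σ (Fin m → Fin n → Fin n) λ f →
  (∀ i → InSEP Γ (f i)) ×
  (∀ i j → f i ≗ f j → i ≡ j) ×
  (∀ σ → InSEP Γ σ → ∃ λ i → σ ≗ f i)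

iter : ∀ {A : Set} → ℕ → (A → A) → A → A
iter zero    f = id
iter (suc k) f = f ∘ iter k f

HasOrder : ∀ {n} → (Fin n → Fin n) → ℕ → Set
HasOrder σ k = 0 < k × (iter k σ ≗ id) × (∀ j → 0 < j → j < k → ¬ (iter j σ ≗ id))

SEPHasElemOfOrder : ∀ {n} → Graph n → ℕ → Set
SEPHasElemOfOrder Γ k = ∃ λ σ → InSEP Γ σ × HasOrder σ k

-- SEP(Γ) consists of the permutations preserving every structural equivalence class (it is the
-- Young subgroup of the partition into classes), so its order is the product of |C|! over the
-- classes C and its prime divisors are the primes up to the largest class size.  If σ has order pq,
-- either some point is moved by both σ^p and σ^q, and its orbit puts pq ≥ p + q points into one
-- class, or σ has a p-cycle and a disjoint q-cycle, lying in one class or in two different ones.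
-- Conversely, disjoint cycles of lengths p and q placed inside classes give an element of order pq.
-- Comparing with the two largest classes yields the stated criteria.

module Submission where

open import Defs
open import Data.Empty using (⊥-elim)
open import Data.Fin as Fin
  using (Fin; zero; suc; toℕ; fromℕ<; punchOut; splitAt; join; _↑ˡ_; _↑ʳ_)
open import Data.Fin.Properties
  using ( suc-injective; toℕ-injective; toℕ-fromℕ<; toℕ<n; injective⇒≤; inject≤-injective
        ; punchOut-injective; punchIn-punchOut; remQuot-combine; combine-remQuot
        ; splitAt-↑ˡ; splitAt-↑ʳ; join-splitAt; ↑ˡ-injective; ↑ʳ-injective; any?; ¬∀⟶∃¬ )
  renaming (_≟_ to _≟ᶠ_)
open import Data.List using (List; []; _∷_; map; length; filter; tabulate)
open import Data.List.Relation.Unary.All using (All; []; _∷_)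
open import Data.List.Relation.Unary.All.Properties using (map⁺)
open import Data.Nat using (ℕ; zero; suc; _≤_; _<_; _+_; _*_; _∸_; z≤n; s≤s; >-nonZero; nonTrivial⇒n>1)
open import Data.Nat.Properties
  using ( _≟_; +-comm; *-comm; *-assoc; +-identityʳ; +-suc; *-suc; +-monoˡ-≤; *-monoˡ-≤
        ; ≤-refl; ≤-trans; ≤-antisym; ≤-reflexive; ≤-pred; ≤-<-trans; <⇒≤; <⇒≱; <-irrefl; ≤∧≢⇒<
        ; <-cmp; n≤1+n; m<n⇒0<n∸m; m∸n≤m; m+[n∸m]≡n; m<m*n )
open import Data.Nat.DivMod using (_%_; m%n<n; m<n⇒m%n≡m; [m+kn]%n≡m%n; %-distribˡ-+; m%n%n≡m%n)
open import Data.Nat.Divisibility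
  using (_∣_; _∣?_; divides; ∣-refl; ∣⇒≤; ∣1⇒≡1; ∣m⇒∣m*n; ∣n⇒∣m*n; m%n≡0⇒n∣m)
open import Data.Nat.Coprimality using (Coprime; coprime-Bézout)
open import Data.Nat.GCD using (module Bézout)
open import Data.Nat.Primality
  using (Prime; euclidsLemma; prime⇒irreducible; prime⇒nonTrivial; prime⇒nonZero; ¬prime[0]; ¬prime[1])
open import Data.Product using (Σ; _×_; _,_; ∃; ∃₂; proj₁; proj₂; uncurry) renaming (map to map×)
open import Data.Sum using (_⊎_; inj₁; inj₂; [_,_]′)
open import Function using (id; _∘_)
open import Function.Bundles using (_⇔_; mk⇔; Equivalence)
open import Function.Definitions using (Injective)
open import Level using (0ℓ)
open import Relation.Nullary using (¬_; Dec; yes; no)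
open import Relation.Unary using (Pred)
open import Relation.Binary using (Rel; Reflexive; IsEquivalence; Decidable; tri<; tri≈; tri>)
open import Relation.Binary.PropositionalEquality

private variable n k : ℕ

-- Transpositions

data SwapCase (u v x : Fin n) : Set where
  at-first  : x ≡ u → SwapCase u v x
  at-second : x ≢ u → x ≡ v → SwapCase u v x
  elsewhere : x ≢ u → x ≢ v → SwapCase u v x

swapCase : (u v x : Fin n) → SwapCase u v x
swapCase u v x with x ≟ᶠ u
... | yes x≡u = at-first x≡u
... | no x≢u with x ≟ᶠ v
...   | yes x≡v = at-second x≢u x≡v
...   | no x≢v  = elsewhere x≢u x≢v

swap-first : (u v : Fin n) → swap u v u ≡ v
swap-first u v with u ≟ᶠ u
... | yes _   = refl
... | no u≢u = ⊥-elim (u≢u refl)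

swap-second : (u v : Fin n) → swap u v v ≡ u
swap-second u v with v ≟ᶠ u
... | yes v≡u = v≡u
... | no _ with v ≟ᶠ v
...   | yes _   = refl
...   | no v≢v = ⊥-elim (v≢v refl)

swap-other : (u v : Fin n) {x : Fin n} → x ≢ u → x ≢ v → swap u v x ≡ x
swap-other u v {x} x≢u x≢v with x ≟ᶠ u
... | yes x≡u = ⊥-elim (x≢u x≡u)
... | no _ with x ≟ᶠ v
...   | yes x≡v = ⊥-elim (x≢v x≡v)
...   | no _    = refl

swap-involutive : (u v : Fin n) → swap u v ∘ swap u v ≗ id
swap-involutive u v x with swapCase u v x
... | at-first refl      = trans (cong (swap x v) (swap-first x v)) (swap-second x v)
... | at-second _ refl   = trans (cong (swap u x) (swap-second u x)) (swap-first u x)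
... | elsewhere x≢u x≢v = trans (cong (swap u v) (swap-other u v x≢u x≢v)) (swap-other u v x≢u x≢v)

swap-injective : (u v : Fin n) → Injective _≡_ _≡_ (swap u v)
swap-injective u v {x} {y} eq =
  trans (sym (swap-involutive u v x)) (trans (cong (swap u v) eq) (swap-involutive u v y))

swap-self : (u : Fin n) → swap u u ≗ id
swap-self u x with swapCase u u x
... | at-first refl       = swap-first x x
... | at-second x≢u x≡u = ⊥-elim (x≢u x≡u)
... | elsewhere x≢u _     = swap-other u u x≢u x≢u

swap-comm : (u v : Fin n) → swap v u ≗ swap u v
swap-comm u v x with swapCase u v x
... | at-first refl      = trans (swap-second v x) (sym (swap-first x v))
... | at-second _ refl   = trans (swap-first x u) (sym (swap-second u x))
... | elsewhere x≢u x≢v = trans (swap-other v u x≢v x≢u) (sym (swap-other u v x≢u x≢v))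

module _ where
  open ≡-Reasoning

  swap-conjugate : {u v w : Fin n} → u ≢ v → v ≢ w → u ≢ w →
                   swap u v ∘ swap v w ∘ swap u v ≗ swap u w
  swap-conjugate {u = u} {v} {w} u≢v v≢w u≢w x with swapCase u v x
  ... | at-first refl = begin
    swap x v (swap v w (swap x v x))  ≡⟨ cong (swap x v ∘ swap v w) (swap-first x v) ⟩
    swap x v (swap v w v)             ≡⟨ cong (swap x v) (swap-first v w) ⟩
    swap x v w                        ≡⟨ swap-other x v (u≢w ∘ sym) (v≢w ∘ sym) ⟩
    w                                 ≡⟨ swap-first x w ⟨
    swap x w x                        ∎
  ... | at-second x≢u refl = begin
    swap u x (swap x w (swap u x x))  ≡⟨ cong (swap u x ∘ swap x w) (swap-second u x) ⟩
    swap u x (swap x w u)             ≡⟨ cong (swap u x) (swap-other x w u≢v u≢w) ⟩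
    swap u x u                        ≡⟨ swap-first u x ⟩
    x                                 ≡⟨ swap-other u w x≢u v≢w ⟨
    swap u w x                        ∎
  ... | elsewhere x≢u x≢v with swapCase u w x
  ...   | at-first x≡u     = ⊥-elim (x≢u x≡u)
  ...   | at-second _ refl = begin
    swap u v (swap v x (swap u v x))  ≡⟨ cong (swap u v ∘ swap v x) (swap-other u v x≢u x≢v) ⟩
    swap u v (swap v x x)             ≡⟨ cong (swap u v) (swap-second v x) ⟩
    swap u v v                        ≡⟨ swap-second u v ⟩
    u                                 ≡⟨ swap-second u x ⟨
    swap u x x                        ∎
  ...   | elsewhere _ x≢w  = begin
    swap u v (swap v w (swap u v x))  ≡⟨ cong (swap u v ∘ swap v w) (swap-other u v x≢u x≢v) ⟩
    swap u v (swap v w x)             ≡⟨ cong (swap u v) (swap-other v w x≢v x≢w) ⟩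
    swap u v x                        ≡⟨ swap-other u v x≢u x≢v ⟩
    x                                 ≡⟨ swap-other u w x≢u x≢w ⟨
    swap u w x                        ∎

swap-lift : (u v : Fin n) → Fin.lift 1 (swap u v) ≗ swap (suc u) (suc v)
swap-lift u v zero    = refl
swap-lift u v (suc x) with x ≟ᶠ u
... | yes _ = refl
... | no _ with x ≟ᶠ v
...   | yes _ = refl
...   | no _  = refl

ClassPreserving : Rel (Fin n) 0ℓ → (Fin n → Fin n) → Set
ClassPreserving R σ = ∀ x → R x (σ x)

SwapsWithin : Rel (Fin n) 0ℓ → List (Fin n × Fin n) → Set
SwapsWithin R = All (λ uv → R (proj₁ uv) (proj₂ uv))

ProductOfSwapsWithin : Rel (Fin n) 0ℓ → (Fin n → Fin n) → Set
ProductOfSwapsWithin {n} R σ = Σ (List (Fin n × Fin n)) λ ts → SwapsWithin R ts × σ ≗ prodSwaps ts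

prodSwaps-injective : (ts : List (Fin n × Fin n)) → Injective _≡_ _≡_ (prodSwaps ts)
prodSwaps-injective []             eq = eq
prodSwaps-injective ((u , v) ∷ ts) eq = prodSwaps-injective ts (swap-injective u v eq)

prodSwaps-lift : (ts : List (Fin n × Fin n)) →
                 Fin.lift 1 (prodSwaps ts) ≗ prodSwaps (map (map× suc suc) ts)
prodSwaps-lift []             zero    = refl
prodSwaps-lift []             (suc x) = refl
prodSwaps-lift ((u , v) ∷ ts) zero    = cong (swap (suc u) (suc v)) (prodSwaps-lift ts zero)
prodSwaps-lift ((u , v) ∷ ts) (suc x) =
  trans (swap-lift u v (suc (prodSwaps ts x))) (cong (swap (suc u) (suc v)) (prodSwaps-lift ts (suc x)))

module _ {n : ℕ} {R : Rel (Fin n) 0ℓ} (isEq : IsEquivalence R) where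
  open IsEquivalence isEq using () renaming (refl to ~-refl; sym to ~-sym; trans to ~-trans)

  swap-classPreserving : {u v : Fin n} → R u v → ClassPreserving R (swap u v)
  swap-classPreserving {u} {v} u~v x with swapCase u v x
  ... | at-first refl      = subst (R x) (sym (swap-first x v)) u~v
  ... | at-second _ refl   = subst (R x) (sym (swap-second u x)) (~-sym u~v)
  ... | elsewhere x≢u x≢v = subst (R x) (sym (swap-other u v x≢u x≢v)) ~-refl

  prodSwaps-classPreserving : (ts : List (Fin n × Fin n)) → SwapsWithin R ts → ClassPreserving R (prodSwaps ts)
  prodSwaps-classPreserving []             []           x = ~-refl
  prodSwaps-classPreserving ((u , v) ∷ ts) (u~v ∷ ts~) x =
    ~-trans (prodSwaps-classPreserving ts ts~ x) (swap-classPreserving u~v (prodSwaps ts x))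

  productOfSwaps⇒classPreserving : {σ : Fin n → Fin n} → ProductOfSwapsWithin R σ → ClassPreserving R σ
  productOfSwaps⇒classPreserving (ts , ts~ , σ≗ts) x =
    subst (R x) (sym (σ≗ts x)) (prodSwaps-classPreserving ts ts~ x)

productOfSwaps⇒injective : {R : Rel (Fin n) 0ℓ} {σ : Fin n → Fin n} →
                           ProductOfSwapsWithin R σ → Injective _≡_ _≡_ σ
productOfSwaps⇒injective (ts , _ , σ≗ts) {x} {y} eq =
  prodSwaps-injective ts (trans (sym (σ≗ts x)) (trans eq (σ≗ts y)))

-- Counting

count : {P : Pred (Fin n) 0ℓ} → (∀ x → Dec (P x)) → ℕ
count {zero}  P? = 0
count {suc n} P? with P? zero
... | yes _ = suc (count (P? ∘ suc))
... | no _  = count (P? ∘ suc)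

length-filter-tabulate : {A : Set} {P : Pred A 0ℓ} (P? : ∀ x → Dec (P x)) (f : Fin n → A) →
                         length (filter P? (tabulate f)) ≡ count (P? ∘ f)
length-filter-tabulate {zero}  P? f = refl
length-filter-tabulate {suc n} P? f with P? (f zero)
... | yes _ = cong suc (length-filter-tabulate P? (f ∘ suc))
... | no _  = length-filter-tabulate P? (f ∘ suc)

record Enumeration (P : Pred (Fin n) 0ℓ) (k : ℕ) : Set where
  field
    elem            : Fin k → Fin n
    elem-satisfies  : ∀ i → P (elem i)
    elem-injective  : Injective _≡_ _≡_ elem
    elem-surjective : ∀ {x} → P x → ∃ λ i → elem i ≡ x

module _ {P : Pred (Fin (suc n)) 0ℓ} (E : Enumeration (P ∘ suc) k) where
  open Enumeration E

  enumeration-cons : P zero → Enumeration P (suc k)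
  enumeration-cons p₀ = record
    { elem            = λ { zero → zero ; (suc i) → suc (elem i) }
    ; elem-satisfies  = λ { zero → p₀ ; (suc i) → elem-satisfies i }
    ; elem-injective  = λ { {zero} {zero} _ → refl
                          ; {suc i} {suc j} eq → cong suc (elem-injective (suc-injective eq)) }
    ; elem-surjective = λ { {zero} _ → zero , refl
                          ; {suc x} p → let i , eq = elem-surjective p in suc i , cong suc eq }
    }

  enumeration-skip : ¬ P zero → Enumeration P k
  enumeration-skip ¬p₀ = record
    { elem            = suc ∘ elem
    ; elem-satisfies  = elem-satisfies
    ; elem-injective  = elem-injective ∘ suc-injective
    ; elem-surjective = λ { {zero} p → ⊥-elim (¬p₀ p)
                          ; {suc x} p → let i , eq = elem-surjective p in i , cong suc eq }
    }

enumerate : {P : Pred (Fin n) 0ℓ} (P? : ∀ x → Dec (P x)) → Enumeration P (count P?)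
enumerate {zero}  P? = record
  { elem = λ () ; elem-satisfies = λ () ; elem-injective = λ { {()} } ; elem-surjective = λ { {()} } }
enumerate {suc n} P? with P? zero
... | yes p₀ = enumeration-cons (enumerate (P? ∘ suc)) p₀
... | no ¬p₀ = enumeration-skip (enumerate (P? ∘ suc)) ¬p₀

module _ {P : Pred (Fin n) 0ℓ} (P? : ∀ x → Dec (P x)) where
  open Enumeration (enumerate P?)

  count-lowerBound : (g : Fin k → Fin n) → Injective _≡_ _≡_ g → (∀ i → P (g i)) → k ≤ count P?
  count-lowerBound g g-injective g-satisfies = injective⇒≤ index-injective
    where
    index : ∀ i → ∃ λ j → elem j ≡ g i
    index i = elem-surjective (g-satisfies i)
    index-injective : Injective _≡_ _≡_ (proj₁ ∘ index)
    index-injective {i} {j} eq =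
      g-injective (trans (sym (proj₂ (index i))) (trans (cong elem eq) (proj₂ (index j))))

  count-nonZero⇒∃ : 0 < count P? → ∃ P
  count-nonZero⇒∃ 0<count = _ , elem-satisfies (Fin.fromℕ< 0<count)

count-mono : {P Q : Pred (Fin n) 0ℓ} (P? : ∀ x → Dec (P x)) (Q? : ∀ x → Dec (Q x)) →
             (∀ {x} → P x → Q x) → count P? ≤ count Q?
count-mono P? Q? P⇒Q = count-lowerBound Q? elem elem-injective (P⇒Q ∘ elem-satisfies)
  where open Enumeration (enumerate P?)

count-cong : {P Q : Pred (Fin n) 0ℓ} (P? : ∀ x → Dec (P x)) (Q? : ∀ x → Dec (Q x)) →
             (∀ {x} → P x → Q x) → (∀ {x} → Q x → P x) → count P? ≡ count Q?
count-cong P? Q? P⇒Q Q⇒P = ≤-antisym (count-mono P? Q? P⇒Q) (count-mono Q? P? Q⇒P)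

module _ {P : Pred (Fin (suc n)) 0ℓ} (P? : ∀ x → Dec (P x)) where

  count-suc-yes : P zero → count P? ≡ suc (count (P? ∘ suc))
  count-suc-yes p₀ with P? zero
  ... | yes _  = refl
  ... | no ¬p₀ = ⊥-elim (¬p₀ p₀)

  count-suc-no : ¬ P zero → count P? ≡ count (P? ∘ suc)
  count-suc-no ¬p₀ with P? zero
  ... | yes p₀ = ⊥-elim (¬p₀ p₀)
  ... | no _   = refl

  count-tail-≤ : count (P? ∘ suc) ≤ count P?
  count-tail-≤ with P? zero
  ... | yes _ = n≤1+n _
  ... | no _  = ≤-refl

≤count⇒embedding : {P : Pred (Fin n) 0ℓ} (P? : ∀ x → Dec (P x)) → k ≤ count P? →
                   ∃ λ (g : Fin k → Fin n) → Injective _≡_ _≡_ g × (∀ i → P (g i))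
≤count⇒embedding P? k≤count =
  (λ i → elem (Fin.inject≤ i k≤count)) ,
  (λ eq → inject≤-injective k≤count k≤count _ _ (elem-injective eq)) ,
  (λ i → elem-satisfies (Fin.inject≤ i k≤count))
  where open Enumeration (enumerate P?)

-- Primes and periods

prime⇒≥2 : ∀ {p} → Prime p → 2 ≤ p
prime⇒≥2 {p} p-prime = nonTrivial⇒n>1 p ⦃ prime⇒nonTrivial p-prime ⦄

prime⇒>0 : ∀ {p} → Prime p → 0 < p
prime⇒>0 p-prime = ≤-trans (s≤s z≤n) (prime⇒≥2 p-prime)

m+n≤m*n : ∀ {m n} → 2 ≤ m → 2 ≤ n → m + n ≤ m * n
m+n≤m*n {m} {suc n} 2≤m (s≤s 1≤n) = begin
  m + suc n           ≡⟨ +-comm m (suc n) ⟩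
  suc n + m           ≤⟨ +-monoˡ-≤ m (+-monoˡ-≤ n 1≤n) ⟩
  (n + n) + m         ≡⟨ cong (λ k → (n + k) + m) (sym (+-identityʳ n)) ⟩
  2 * n + m           ≤⟨ +-monoˡ-≤ m (*-monoˡ-≤ n 2≤m) ⟩
  m * n + m           ≡⟨ +-comm (m * n) m ⟩
  m + m * n           ≡⟨ *-suc m n ⟨
  m * suc n           ∎
  where open Data.Nat.Properties.≤-Reasoning

prime∤⇒coprime : ∀ {p a} → Prime p → ¬ p ∣ a → Coprime a p
prime∤⇒coprime p-prime p∤a (d∣a , d∣p) with prime⇒irreducible p-prime d∣p
... | inj₁ d≡1  = d≡1
... | inj₂ refl = ⊥-elim (p∤a d∣a)

distinctPrimes-∣⇒*∣ : ∀ {p q d} → Prime p → Prime q → p ≢ q → p ∣ d → q ∣ d → p * q ∣ d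
distinctPrimes-∣⇒*∣ {p} {q} p-prime q-prime p≢q (divides k refl) q∣kp with euclidsLemma k p q-prime q∣kp
... | inj₁ (divides l refl) = divides l (trans (*-assoc l q p) (cong (l *_) (*-comm q p)))
... | inj₂ q∣p with prime⇒irreducible p-prime q∣p
...   | inj₁ refl = ⊥-elim (¬prime[1] q-prime)
...   | inj₂ refl = ⊥-elim (p≢q refl)

module _ {A : Set} (f : A → A) where

  iter-+ : ∀ a b → iter (a + b) f ≗ iter a f ∘ iter b f
  iter-+ zero    b x = refl
  iter-+ (suc a) b x = cong f (iter-+ a b x)

  iter-* : ∀ a b → iter (a * b) f ≗ iter a (iter b f)
  iter-* zero    b x = refl
  iter-* (suc a) b x = trans (iter-+ b (a * b) x) (cong (iter b f) (iter-* a b x))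

  iter-comm : ∀ a b → iter a f ∘ iter b f ≗ iter b f ∘ iter a f
  iter-comm a b x = trans (sym (iter-+ a b x)) (trans (cong (λ k → iter k f x) (+-comm a b)) (iter-+ b a x))

  iter-fixedPoint : ∀ k {x} → f x ≡ x → iter k f x ≡ x
  iter-fixedPoint zero    fx≡x = refl
  iter-fixedPoint (suc k) fx≡x = trans (cong f (iter-fixedPoint k fx≡x)) fx≡x

  iter-injective : Injective _≡_ _≡_ f → ∀ k → Injective _≡_ _≡_ (iter k f)
  iter-injective f-injective zero    eq = eq
  iter-injective f-injective (suc k) eq = iter-injective f-injective k (f-injective eq)

NoEarlierReturn : {A : Set} → (A → A) → A → ℕ → Set
NoEarlierReturn f x k = ∀ d → 0 < d → d < k → iter d f x ≢ x

module Orbit {A : Set} {f : A → A} (f-injective : Injective _≡_ _≡_ f) (x : A) where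

  Returns : ℕ → Set
  Returns k = iter k f x ≡ x

  returns-* : ∀ a b → Returns b → Returns (a * b)
  returns-* a b x↺b = trans (iter-* f a b x) (iter-fixedPoint (iter b f) a x↺b)

  returns-*ʳ : ∀ a b → Returns a → Returns (a * b)
  returns-*ʳ a b x↺a = subst Returns (*-comm b a) (returns-* b a x↺a)

  returns-shift : ∀ a d → iter a f x ≡ iter (a + d) f x → Returns d
  returns-shift a d eq = iter-injective f f-injective a (trans (sym (iter-+ f a d x)) (sym eq))

  returns-consecutive : ∀ a → Returns a → Returns (1 + a) → f x ≡ x
  returns-consecutive a x↺a x↺1+a = returns-shift a 1 (trans x↺a (sym (subst Returns (+-comm 1 a) x↺1+a)))

  -- Bézout turns the return times p and a into two consecutive return times.
  returns-coprime : ∀ {p a} → Prime p → Returns p → Returns a → ¬ p ∣ a → f x ≡ x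
  returns-coprime {p} {a} p-prime x↺p x↺a p∤a with coprime-Bézout (prime∤⇒coprime p-prime p∤a)
  ... | Bézout.+- u v 1+vp≡ua =
    returns-consecutive (v * p) (returns-* v p x↺p) (subst Returns (sym 1+vp≡ua) (returns-* u a x↺a))
  ... | Bézout.-+ u v 1+ua≡vp =
    returns-consecutive (u * a) (returns-* u a x↺a) (subst Returns (sym 1+ua≡vp) (returns-* v p x↺p))

  returns-distinct : ∀ {k} → NoEarlierReturn f x k → ∀ {a b} → a < b → b < k → iter a f x ≢ iter b f x
  returns-distinct none {a} {b} a<b b<k eq = none (b ∸ a) (m<n⇒0<n∸m a<b) (≤-<-trans (m∸n≤m b a) b<k)
    (returns-shift a (b ∸ a) (trans eq (cong (λ t → iter t f x) (sym (m+[n∸m]≡n (<⇒≤ a<b))))))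

  orbit-injective : ∀ {k} → NoEarlierReturn f x k → Injective _≡_ _≡_ (λ (i : Fin k) → iter (toℕ i) f x)
  orbit-injective none {i} {j} eq with <-cmp (toℕ i) (toℕ j)
  ... | tri< i<j _ _ = ⊥-elim (returns-distinct none i<j (toℕ<n j) eq)
  ... | tri≈ _ i≡j _ = toℕ-injective i≡j
  ... | tri> _ _ j<i = ⊥-elim (returns-distinct none j<i (toℕ<n i) (sym eq))

  noEarlierReturn-prime : ∀ {p} → Prime p → Returns p → f x ≢ x → NoEarlierReturn f x p
  noEarlierReturn-prime p-prime x↺p fx≢x d 0<d d<p x↺d =
    fx≢x (returns-coprime p-prime x↺p x↺d (λ p∣d → <⇒≱ d<p (∣⇒≤ ⦃ >-nonZero 0<d ⦄ p∣d)))

module _ {A : Set} {f : A → A} (f-injective : Injective _≡_ _≡_ f) {p q} (p-prime : Prime p) (q-prime : Prime q)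
         (p≢q : p ≢ q) {x : A} (x↺pq : iter (p * q) f x ≡ x) where

  -- A return time d < pq is a multiple of p, else x would be fixed by f^q, and likewise of q.
  noEarlierReturn-product : iter p f x ≢ x → iter q f x ≢ x → NoEarlierReturn f x (p * q)
  noEarlierReturn-product fᵖx≢x fᵠx≢x d 0<d d<pq x↺d with p ∣? d | q ∣? d
  ... | no p∤d | _ = fᵠx≢x (Orbit.returns-coprime (iter-injective f f-injective q) x p-prime
                        (trans (sym (iter-* f p q x)) x↺pq)
                        (trans (sym (iter-* f d q x)) (Orbit.returns-*ʳ f-injective x d q x↺d)) p∤d)
  ... | yes _ | no q∤d = fᵖx≢x (Orbit.returns-coprime (iter-injective f f-injective p) x q-prime
                        (trans (sym (iter-* f q p x)) (subst (λ k → iter k f x ≡ x) (*-comm p q) x↺pq))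
                        (trans (sym (iter-* f d p x)) (Orbit.returns-*ʳ f-injective x d p x↺d)) q∤d)
  ... | yes p∣d | yes q∣d = <⇒≱ d<pq (∣⇒≤ ⦃ >-nonZero 0<d ⦄ (distinctPrimes-∣⇒*∣ p-prime q-prime p≢q p∣d q∣d))

-- Young subgroups

restrict : Rel (Fin (suc n)) 0ℓ → Rel (Fin n) 0ℓ
restrict R i j = R (suc i) (suc j)

restrict? : {R : Rel (Fin (suc n)) 0ℓ} → Decidable R → Decidable (restrict R)
restrict? R? i j = R? (suc i) (suc j)

restrict-isEquivalence : {R : Rel (Fin (suc n)) 0ℓ} → IsEquivalence R → IsEquivalence (restrict R)
restrict-isEquivalence isEq = record
  { refl = IsEquivalence.refl isEq ; sym = IsEquivalence.sym isEq ; trans = IsEquivalence.trans isEq }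

-- The product over i of the number of j ≥ i in the class of i, i.e. the product of |C|! over the classes C.
youngOrder : {R : Rel (Fin n) 0ℓ} → Decidable R → ℕ
youngOrder {zero}  R? = 1
youngOrder {suc n} R? = count (R? zero) * youngOrder (restrict? R?)

record YoungEnumeration (R : Rel (Fin n) 0ℓ) (m : ℕ) : Set where
  field
    perm          : Fin m → Fin n → Fin n
    perm-product  : ∀ i → ProductOfSwapsWithin R (perm i)
    perm-distinct : ∀ i j → perm i ≗ perm j → i ≡ j
    perm-complete : ∀ σ → Injective _≡_ _≡_ σ → ClassPreserving R σ → ∃ λ i → σ ≗ perm i

lift-cong : {f g : Fin n → Fin n} → f ≗ g → Fin.lift 1 f ≗ Fin.lift 1 g
lift-cong f≗g zero    = refl
lift-cong f≗g (suc x) = cong suc (f≗g x)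

module _ {R : Rel (Fin (suc n)) 0ℓ} (isEq : IsEquivalence R) {σ : Fin (suc n) → Fin (suc n)}
         (σ-injective : Injective _≡_ _≡_ σ) (σ-preserving : ClassPreserving R σ) where
  open IsEquivalence isEq using () renaming (trans to ~-trans)

  -- swap 0 (σ 0) ∘ σ fixes 0, so it is the lift of a permutation τ of the remaining points.
  decompose-at-zero : ∃ λ τ → Injective _≡_ _≡_ τ × ClassPreserving (restrict R) τ ×
                              σ ≗ swap zero (σ zero) ∘ Fin.lift 1 τ
  decompose-at-zero = τ , τ-injective , τ-preserving , σ≗
    where
    ρ : Fin (suc n) → Fin (suc n)
    ρ = swap zero (σ zero) ∘ σ
    ρ-injective : Injective _≡_ _≡_ ρ
    ρ-injective = σ-injective ∘ swap-injective zero (σ zero)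
    ρ-zero : ρ zero ≡ zero
    ρ-zero = swap-second zero (σ zero)
    zero≢ρsuc : ∀ i → zero ≢ ρ (suc i)
    zero≢ρsuc i eq with ρ-injective (trans ρ-zero eq)
    ... | ()
    τ : Fin n → Fin n
    τ i = punchOut (zero≢ρsuc i)
    ρ≗ : ρ ≗ Fin.lift 1 τ
    ρ≗ zero    = ρ-zero
    ρ≗ (suc i) = sym (punchIn-punchOut (zero≢ρsuc i))
    τ-injective : Injective _≡_ _≡_ τ
    τ-injective = suc-injective ∘ ρ-injective ∘ punchOut-injective (zero≢ρsuc _) (zero≢ρsuc _)
    τ-preserving : ClassPreserving (restrict R) τ
    τ-preserving i = subst (R (suc i)) (ρ≗ (suc i))
      (~-trans (σ-preserving (suc i)) (swap-classPreserving isEq (σ-preserving zero) (σ (suc i))))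
    σ≗ : σ ≗ swap zero (σ zero) ∘ Fin.lift 1 τ
    σ≗ x = trans (sym (swap-involutive zero (σ zero) (σ x))) (cong (swap zero (σ zero)) (ρ≗ x))

enumerateYoung : {R : Rel (Fin n) 0ℓ} (R? : Decidable R) → IsEquivalence R → YoungEnumeration R (youngOrder R?)
enumerateYoung {zero} R? isEq = record
  { perm          = λ _ → id
  ; perm-product  = λ _ → [] , [] , λ ()
  ; perm-distinct = λ { zero zero _ → refl }
  ; perm-complete = λ _ _ _ → zero , λ ()
  }
enumerateYoung {suc n} {R} R? isEq = record
  { perm          = uncurry perm′ ∘ Fin.remQuot m′
  ; perm-product  = λ k → perm′-product (Fin.remQuot m′ k)
  ; perm-distinct = perm-distinct
  ; perm-complete = perm-complete
  }
  where
  module C = Enumeration (enumerate (R? zero))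
  module T = YoungEnumeration (enumerateYoung (restrict? R?) (restrict-isEquivalence isEq))
  m′ : ℕ
  m′ = youngOrder (restrict? R?)

  perm′ : Fin (count (R? zero)) → Fin m′ → Fin (suc n) → Fin (suc n)
  perm′ c t = swap zero (C.elem c) ∘ Fin.lift 1 (T.perm t)

  perm′-product : ∀ ct → ProductOfSwapsWithin R (uncurry perm′ ct)
  perm′-product (c , t) with T.perm-product t
  ... | ts , ts~ , τ≗ts =
    (zero , C.elem c) ∷ map (map× suc suc) ts , C.elem-satisfies c ∷ map⁺ ts~ ,
    λ x → cong (swap zero (C.elem c)) (trans (lift-cong τ≗ts x) (prodSwaps-lift ts x))

  perm′-distinct : ∀ {c c′ t t′} → perm′ c t ≗ perm′ c′ t′ → (c , t) ≡ (c′ , t′)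
  perm′-distinct {c} {c′} {t} {t′} eq = cong₂ _,_ c≡c′ (T.perm-distinct t t′ τ≗τ′)
    where
    c≡c′ : c ≡ c′
    c≡c′ = C.elem-injective (trans (sym (swap-first zero (C.elem c))) (trans (eq zero) (swap-first zero (C.elem c′))))
    τ≗τ′ : T.perm t ≗ T.perm t′
    τ≗τ′ x = suc-injective (swap-injective zero (C.elem c)
      (trans (eq (suc x)) (cong (λ c → swap zero (C.elem c) (suc (T.perm t′ x))) (sym c≡c′))))

  perm-distinct : ∀ k k′ → uncurry perm′ (Fin.remQuot m′ k) ≗ uncurry perm′ (Fin.remQuot m′ k′) → k ≡ k′
  perm-distinct k k′ eq = trans (sym (combine-remQuot {count (R? zero)} m′ k))
    (trans (cong (uncurry Fin.combine) (perm′-distinct eq)) (combine-remQuot {count (R? zero)} m′ k′))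

  perm-complete : ∀ σ → Injective _≡_ _≡_ σ → ClassPreserving R σ →
                  ∃ λ k → σ ≗ uncurry perm′ (Fin.remQuot m′ k)
  perm-complete σ σ-injective σ-preserving with decompose-at-zero isEq σ-injective σ-preserving
  ... | τ , τ-injective , τ-preserving , σ≗ with C.elem-surjective (σ-preserving zero)
                                             | T.perm-complete τ τ-injective τ-preserving
  ...   | c , c↦σ₀ | t , τ≗t = Fin.combine c t , λ x → begin
    σ x                                        ≡⟨ σ≗ x ⟩
    swap zero (σ zero) (Fin.lift 1 τ x)        ≡⟨ cong₂ (swap zero) (sym c↦σ₀) (lift-cong τ≗t x) ⟩
    perm′ c t x                                ≡⟨ cong (λ ct → uncurry perm′ ct x) (remQuot-combine c t) ⟨
    uncurry perm′ (Fin.remQuot m′ (Fin.combine c t)) x ∎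
    where open ≡-Reasoning

module _ {R : Rel (Fin n) 0ℓ} (R? : Decidable R) (isEq : IsEquivalence R) where
  open IsEquivalence isEq using () renaming (refl to ~-refl; sym to ~-sym; trans to ~-trans)

  count-class-cong : ∀ {u v} → R u v → count (R? u) ≡ count (R? v)
  count-class-cong u~v = count-cong (R? _) (R? _) (~-trans (~-sym u~v)) (~-trans u~v)

  count-class-positive : ∀ v → 0 < count (R? v)
  count-class-positive v = count-lowerBound (R? v) (λ _ → v) (λ { {zero} {zero} _ → refl }) (λ _ → ~-refl)

prime∣youngOrder⇒ : {R : Rel (Fin n) 0ℓ} (R? : Decidable R) → IsEquivalence R →
                    ∀ {p} → Prime p → p ∣ youngOrder R? → ∃ λ v → p ≤ count (R? v)
prime∣youngOrder⇒ {zero}  R? isEq p-prime p∣1 = ⊥-elim (¬prime[1] (subst Prime (∣1⇒≡1 p∣1) p-prime))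
prime∣youngOrder⇒ {suc n} R? isEq {p} p-prime p∣order
  with euclidsLemma (count (R? zero)) (youngOrder (restrict? R?)) p-prime p∣order
... | inj₁ p∣count = zero , ∣⇒≤ ⦃ >-nonZero (count-class-positive R? isEq zero) ⦄ p∣count
... | inj₂ p∣rest with prime∣youngOrder⇒ (restrict? R?) (restrict-isEquivalence isEq) p-prime p∣rest
...   | v , p≤count = suc v , ≤-trans p≤count (count-tail-≤ (R? (suc v)))

∣youngOrder : {R : Rel (Fin n) 0ℓ} (R? : Decidable R) → IsEquivalence R →
              ∀ {k} v → 0 < k → k ≤ count (R? v) → k ∣ youngOrder R?
∣youngOrder-class₀ : {R : Rel (Fin (suc n)) 0ℓ} (R? : Decidable R) → IsEquivalence R →
                     ∀ {k} → 0 < k → k ≤ count (R? zero) → k ∣ youngOrder R?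

∣youngOrder {suc n} R? isEq zero 0<k k≤count = ∣youngOrder-class₀ R? isEq 0<k k≤count
∣youngOrder {suc n} R? isEq {k} (suc v) 0<k k≤count with R? zero (suc v)
... | yes 0~v = ∣youngOrder-class₀ R? isEq 0<k (subst (k ≤_) (sym (count-class-cong R? isEq 0~v)) k≤count)
... | no 0≁v  = ∣n⇒∣m*n (count (R? zero)) (∣youngOrder (restrict? R?) (restrict-isEquivalence isEq) v 0<k
                  (subst (k ≤_) (count-suc-no (R? (suc v)) (0≁v ∘ IsEquivalence.sym isEq)) k≤count))

∣youngOrder-class₀ {n} {R} R? isEq {k} 0<k k≤a with k ≟ count (R? zero)
... | yes refl = ∣m⇒∣m*n (youngOrder (restrict? R?)) ∣-refl
... | no k≢a   = ∣n⇒∣m*n (count (R? zero)) (∣youngOrder (restrict? R?) (restrict-isEquivalence isEq) j 0<k k≤count-j)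
  where
  open IsEquivalence isEq using () renaming (refl to ~-refl; sym to ~-sym)
  k<a : k < count (R? zero)
  k<a = ≤∧≢⇒< k≤a k≢a
  second : ∃ λ j → R zero (suc j)
  second = count-nonZero⇒∃ (R? zero ∘ suc) (≤-trans 0<k (≤-pred (subst (k <_) (count-suc-yes (R? zero) ~-refl) k<a)))
  j : Fin n
  j = proj₁ second
  a≡1+count-j : count (R? zero) ≡ suc (count (restrict? R? j))
  a≡1+count-j = trans (count-class-cong R? isEq (proj₂ second)) (count-suc-yes (R? (suc j)) (~-sym (proj₂ second)))
  k≤count-j : k ≤ count (restrict? R? j)
  k≤count-j = ≤-pred (subst (k <_) a≡1+count-j k<a)

-- Elements of order pq

↑ˡ≢↑ʳ : ∀ {m n} (i : Fin m) (j : Fin n) → i ↑ˡ n ≢ m ↑ʳ j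
↑ˡ≢↑ʳ {m} {n} i j eq with trans (sym (splitAt-↑ˡ m i n)) (trans (cong (splitAt m) eq) (splitAt-↑ʳ m n j))
... | ()

-- A p-cycle and a q-cycle fit into the classes: both in one class, or in two different ones.
CyclesFit : ∀ {n} {R : Rel (Fin n) 0ℓ} → Decidable R → ℕ → ℕ → Set
CyclesFit {R = R} R? p q = (∃ λ z → p + q ≤ count (R? z))
                         ⊎ (∃₂ λ x y → ¬ R x y × p ≤ count (R? x) × q ≤ count (R? y))

module _ {n} {R : Rel (Fin n) 0ℓ} (R? : Decidable R) (isEq : IsEquivalence R) where
  open IsEquivalence isEq using () renaming (refl to ~-refl; sym to ~-sym; trans to ~-trans)

  iter-classPreserving : ∀ {σ} → ClassPreserving R σ → ∀ k → ClassPreserving R (iter k σ)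
  iter-classPreserving σ-preserving zero    x = ~-refl
  iter-classPreserving σ-preserving (suc k) x =
    ~-trans (iter-classPreserving σ-preserving k x) (σ-preserving (iter k _ x))

  count-disjoint-+ : ∀ {p q} z (A : Fin p → Fin n) (B : Fin q → Fin n) →
                     Injective _≡_ _≡_ A → Injective _≡_ _≡_ B → (∀ i j → A i ≢ B j) →
                     (∀ i → R z (A i)) → (∀ j → R z (B j)) → p + q ≤ count (R? z)
  count-disjoint-+ {p} {q} z A B A-injective B-injective A≢B z~A z~B =
    count-lowerBound (R? z) (AB ∘ splitAt p) AB-injective (λ k → z~AB (splitAt p k))
    where
    AB : Fin p ⊎ Fin q → Fin n
    AB = [ A , B ]′
    z~AB : ∀ s → R z (AB s)
    z~AB (inj₁ i) = z~A i
    z~AB (inj₂ j) = z~B j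
    AB-injective′ : Injective _≡_ _≡_ AB
    AB-injective′ {inj₁ i} {inj₁ i′} eq = cong inj₁ (A-injective eq)
    AB-injective′ {inj₁ i} {inj₂ j}  eq = ⊥-elim (A≢B i j eq)
    AB-injective′ {inj₂ j} {inj₁ i}  eq = ⊥-elim (A≢B i j (sym eq))
    AB-injective′ {inj₂ j} {inj₂ j′} eq = cong inj₂ (B-injective eq)
    AB-injective : Injective _≡_ _≡_ (AB ∘ splitAt p)
    AB-injective {k} {k′} eq =
      trans (sym (join-splitAt p q k))
            (trans (cong (join p q) (AB-injective′ {splitAt p k} {splitAt p k′} eq)) (join-splitAt p q k′))

  module _ {σ : Fin n → Fin n} (σ-injective : Injective _≡_ _≡_ σ) (σ-preserving : ClassPreserving R σ) where

    orbit : ∀ {k} → Fin n → Fin k → Fin n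
    orbit x i = iter (toℕ i) σ x

    orbit-≤-count : ∀ {k} x → NoEarlierReturn σ x k → k ≤ count (R? x)
    orbit-≤-count x none = count-lowerBound (R? x) (orbit x) (Orbit.orbit-injective σ-injective x none)
                                            (λ i → iter-classPreserving σ-preserving (toℕ i) x)

    noEarlierReturn-prime-orbit : ∀ {p q x} → Prime p → iter p σ x ≡ x → iter q σ x ≢ x → NoEarlierReturn σ x p
    noEarlierReturn-prime-orbit {q = q} {x} p-prime σᵖx≡x σᵠx≢x =
      Orbit.noEarlierReturn-prime σ-injective x p-prime σᵖx≡x (σᵠx≢x ∘ iter-fixedPoint σ q)

    -- Every point of the orbit of y is fixed by σ^q, no point of the orbit of x is.
    orbits-disjoint : ∀ {q x y} → iter q σ x ≢ x → iter q σ y ≡ y →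
                      ∀ {k l} (i : Fin k) (j : Fin l) → orbit x i ≢ orbit y j
    orbits-disjoint {q} {x} {y} σᵠx≢x σᵠy≡y i j eq = σᵠx≢x (iter-injective σ σ-injective (toℕ i) (begin
      iter (toℕ i) σ (iter q σ x)  ≡⟨ iter-comm σ (toℕ i) q x ⟩
      iter q σ (orbit x i)          ≡⟨ cong (iter q σ) eq ⟩
      iter q σ (orbit y j)          ≡⟨ iter-comm σ q (toℕ j) y ⟩
      iter (toℕ j) σ (iter q σ y)  ≡⟨ cong (iter (toℕ j) σ) σᵠy≡y ⟩
      orbit y j                     ≡⟨ eq ⟨
      orbit x i                     ∎))
      where open ≡-Reasoning

    module _ {p q} (p-prime : Prime p) (q-prime : Prime q) (p≢q : p ≢ q) (σ↺pq : iter (p * q) σ ≗ (λ x → x)) where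

      long-orbit : ∀ {z} → iter p σ z ≢ z → iter q σ z ≢ z → CyclesFit R? p q
      long-orbit {z} σᵖz≢z σᵠz≢z = inj₁ (z , ≤-trans (m+n≤m*n (prime⇒≥2 p-prime) (prime⇒≥2 q-prime))
        (orbit-≤-count z (noEarlierReturn-product σ-injective p-prime q-prime p≢q (σ↺pq z) σᵖz≢z σᵠz≢z)))

      short-orbits : ∀ {x y} → iter p σ x ≡ x → iter q σ x ≢ x →
                     iter q σ y ≡ y → iter p σ y ≢ y → CyclesFit R? p q
      short-orbits {x} {y} σᵖx≡x σᵠx≢x σᵠy≡y σᵖy≢y = fit (R? x y)
        where
        x-period : NoEarlierReturn σ x p
        x-period = noEarlierReturn-prime-orbit {q = q} p-prime σᵖx≡x σᵠx≢x
        y-period : NoEarlierReturn σ y q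
        y-period = noEarlierReturn-prime-orbit {q = p} q-prime σᵠy≡y σᵖy≢y
        fit : Dec (R x y) → CyclesFit R? p q
        fit (yes x~y) = inj₁ (x , count-disjoint-+ x (orbit x) (orbit y)
          (Orbit.orbit-injective σ-injective x x-period) (Orbit.orbit-injective σ-injective y y-period)
          (orbits-disjoint {q} σᵠx≢x σᵠy≡y)
          (λ i → iter-classPreserving σ-preserving (toℕ i) x)
          (λ j → ~-trans x~y (iter-classPreserving σ-preserving (toℕ j) y)))
        fit (no x≁y)  = inj₂ (x , y , x≁y , orbit-≤-count x x-period , orbit-≤-count y y-period)

    hasOrder⇒moves : ∀ {k} → HasOrder σ k → ∀ {d} → 0 < d → d < k → ∃ λ x → iter d σ x ≢ x
    hasOrder⇒moves (_ , _ , minimal) {d} 0<d d<k = ¬∀⟶∃¬ n _ (λ x → iter d σ x ≟ᶠ x) (minimal d 0<d d<k)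

    hasOrder⇒cyclesFit : ∀ {p q} → Prime p → Prime q → p ≢ q → HasOrder σ (p * q) → CyclesFit R? p q
    hasOrder⇒cyclesFit {p} {q} p-prime q-prime p≢q order@(_ , σ↺pq , _)
      with hasOrder⇒moves order (prime⇒>0 q-prime) q<pq | hasOrder⇒moves order (prime⇒>0 p-prime) p<pq
      where
      p<pq : p < p * q
      p<pq = m<m*n p q ⦃ prime⇒nonZero p-prime ⦄ (prime⇒≥2 q-prime)
      q<pq : q < p * q
      q<pq = subst (q <_) (*-comm q p) (m<m*n q p ⦃ prime⇒nonZero q-prime ⦄ (prime⇒≥2 p-prime))
    ... | x , σᵠx≢x | y , σᵖy≢y with iter p σ x ≟ᶠ x | iter q σ y ≟ᶠ y
    ...   | no σᵖx≢x  | _         = long-orbit p-prime q-prime p≢q σ↺pq σᵖx≢x σᵠx≢x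
    ...   | yes _     | no σᵠy≢y  = long-orbit p-prime q-prime p≢q σ↺pq σᵖy≢y σᵠy≢y
    ...   | yes σᵖx≡x | yes σᵠy≡y = short-orbits p-prime q-prime p≢q σ↺pq σᵖx≡x σᵠx≢x σᵠy≡y σᵖy≢y

rotate : Fin (suc k) → Fin (suc k)
rotate {k} i = fromℕ< (m%n<n (suc (toℕ i)) (suc k))

toℕ-iter-rotate : ∀ j (i : Fin (suc k)) → toℕ (iter j rotate i) ≡ (toℕ i + j) % suc k
toℕ-iter-rotate {k} zero i = sym (trans (cong (_% suc k) (+-identityʳ (toℕ i))) (m<n⇒m%n≡m (toℕ<n i)))
toℕ-iter-rotate {k} (suc j) i = begin
  toℕ (rotate (iter j rotate i))       ≡⟨ toℕ-fromℕ< _ ⟩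
  suc (toℕ (iter j rotate i)) % suc k  ≡⟨ cong (λ t → suc t % suc k) (toℕ-iter-rotate j i) ⟩
  suc ((toℕ i + j) % suc k) % suc k    ≡⟨ suc-% (toℕ i + j) ⟩
  suc (toℕ i + j) % suc k              ≡⟨ cong (_% suc k) (+-suc (toℕ i) j) ⟨
  (toℕ i + suc j) % suc k              ∎
  where
  open ≡-Reasoning
  suc-% : ∀ m → suc (m % suc k) % suc k ≡ suc m % suc k
  suc-% m = trans (%-distribˡ-+ 1 (m % suc k) (suc k))
    (trans (cong (λ t → (1 % suc k + t) % suc k) (m%n%n≡m%n m (suc k))) (sym (%-distribˡ-+ 1 m (suc k))))

iter-rotate-period : ∀ c → iter (c * suc k) rotate ≗ id
iter-rotate-period {k} c i = toℕ-injective (begin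
  toℕ (iter (c * suc k) rotate i)  ≡⟨ toℕ-iter-rotate (c * suc k) i ⟩
  (toℕ i + c * suc k) % suc k      ≡⟨ [m+kn]%n≡m%n (toℕ i) c (suc k) ⟩
  toℕ i % suc k                    ≡⟨ m<n⇒m%n≡m (toℕ<n i) ⟩
  toℕ i                            ∎)
  where open ≡-Reasoning

rotate-injective : {i j : Fin (suc k)} → rotate i ≡ rotate j → i ≡ j
rotate-injective {k} {i} {j} eq =
  trans (sym (rotate-left-inverse i)) (trans (cong (iter k rotate) eq) (rotate-left-inverse j))
  where
  rotate-left-inverse : ∀ x → iter k rotate (rotate x) ≡ x
  rotate-left-inverse x = trans (sym (iter-+ rotate k 1 x))
    (trans (cong (λ t → iter t rotate x) (trans (+-comm k 1) (cong suc (sym (+-identityʳ k))))) (iter-rotate-period 1 x))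

iter-rotate-zero : ∀ j → iter j rotate (zero {n = k}) ≡ zero → suc k ∣ j
iter-rotate-zero {k} j eq = m%n≡0⇒n∣m j (suc k) (trans (sym (toℕ-iter-rotate j zero)) (cong toℕ eq))

module DoubleRotation {n p′ q′} (A : Fin (suc p′) → Fin n) (B : Fin (suc q′) → Fin n)
                      (A-injective : Injective _≡_ _≡_ A) (B-injective : Injective _≡_ _≡_ B)
                      (A≢B : ∀ i j → A i ≢ B j) where

  in-A? : ∀ x → Dec (∃ λ i → A i ≡ x)
  in-A? x = any? (λ i → A i ≟ᶠ x)

  in-B? : ∀ x → Dec (∃ λ j → B j ≡ x)
  in-B? x = any? (λ j → B j ≟ᶠ x)

  step : ∀ x → Dec (∃ λ i → A i ≡ x) → Dec (∃ λ j → B j ≡ x) → Fin n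
  step x (yes (i , _)) _             = A (rotate i)
  step x (no _)        (yes (j , _)) = B (rotate j)
  step x (no _)        (no _)        = x

  σ : Fin n → Fin n
  σ x = step x (in-A? x) (in-B? x)

  data View (x : Fin n) : Set where
    in-A  : ∀ i → A i ≡ x → σ x ≡ A (rotate i) → View x
    in-B  : ∀ j → B j ≡ x → σ x ≡ B (rotate j) → View x
    fixed : (∀ i → A i ≢ x) → (∀ j → B j ≢ x) → σ x ≡ x → View x

  view : ∀ x → View x
  view x = view′ (in-A? x) (in-B? x) refl
    where
    view′ : ∀ a? b? → σ x ≡ step x a? b? → View x
    view′ (yes (i , Ai≡x)) _                σx≡ = in-A i Ai≡x σx≡
    view′ (no ∄i)          (yes (j , Bj≡x)) σx≡ = in-B j Bj≡x σx≡
    view′ (no ∄i)          (no ∄j)          σx≡ = fixed (λ i eq → ∄i (i , eq)) (λ j eq → ∄j (j , eq)) σx≡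

  σ-A : ∀ i → σ (A i) ≡ A (rotate i)
  σ-A i with view (A i)
  ... | in-A i′ Ai′≡Ai σ≡ = trans σ≡ (cong (A ∘ rotate) (A-injective Ai′≡Ai))
  ... | in-B j Bj≡Ai _    = ⊥-elim (A≢B i j (sym Bj≡Ai))
  ... | fixed A≢ _ _      = ⊥-elim (A≢ i refl)

  σ-B : ∀ j → σ (B j) ≡ B (rotate j)
  σ-B j with view (B j)
  ... | in-A i Ai≡Bj _    = ⊥-elim (A≢B i j Ai≡Bj)
  ... | in-B j′ Bj′≡Bj σ≡ = trans σ≡ (cong (B ∘ rotate) (B-injective Bj′≡Bj))
  ... | fixed _ B≢ _      = ⊥-elim (B≢ j refl)

  σ-injective : Injective _≡_ _≡_ σ
  σ-injective {x} {y} σx≡σy with view x | view y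
  ... | in-A i refl σ≡ | in-A i′ refl σ≡′ = cong A (rotate-injective (A-injective (trans (sym σ≡) (trans σx≡σy σ≡′))))
  ... | in-A i _ σ≡    | in-B j _ σ≡′     = ⊥-elim (A≢B _ _ (trans (sym σ≡) (trans σx≡σy σ≡′)))
  ... | in-A i _ σ≡    | fixed A≢ _ σ≡′   = ⊥-elim (A≢ _ (trans (sym σ≡) (trans σx≡σy σ≡′)))
  ... | in-B j _ σ≡    | in-A i _ σ≡′     = ⊥-elim (A≢B _ _ (trans (sym σ≡′) (trans (sym σx≡σy) σ≡)))
  ... | in-B j refl σ≡ | in-B j′ refl σ≡′ = cong B (rotate-injective (B-injective (trans (sym σ≡) (trans σx≡σy σ≡′))))
  ... | in-B j _ σ≡    | fixed _ B≢ σ≡′   = ⊥-elim (B≢ _ (trans (sym σ≡) (trans σx≡σy σ≡′)))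
  ... | fixed A≢ _ σ≡  | in-A i _ σ≡′     = ⊥-elim (A≢ _ (trans (sym σ≡′) (trans (sym σx≡σy) σ≡)))
  ... | fixed _ B≢ σ≡  | in-B j _ σ≡′     = ⊥-elim (B≢ _ (trans (sym σ≡′) (trans (sym σx≡σy) σ≡)))
  ... | fixed _ _ σ≡   | fixed _ _ σ≡′    = trans (sym σ≡) (trans σx≡σy σ≡′)

  σ-classPreserving : {R : Rel (Fin n) 0ℓ} → Reflexive R →
                      (∀ i → R (A i) (A (rotate i))) → (∀ j → R (B j) (B (rotate j))) → ClassPreserving R σ
  σ-classPreserving {R} ~-refl A~ B~ x with view x
  ... | in-A i refl σ≡ = subst (R x) (sym σ≡) (A~ i)
  ... | in-B j refl σ≡ = subst (R x) (sym σ≡) (B~ j)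
  ... | fixed _ _ σ≡   = subst (R x) (sym σ≡) ~-refl

  iter-σ-A : ∀ k i → iter k σ (A i) ≡ A (iter k rotate i)
  iter-σ-A zero    i = refl
  iter-σ-A (suc k) i = trans (cong σ (iter-σ-A k i)) (σ-A _)

  iter-σ-B : ∀ k j → iter k σ (B j) ≡ B (iter k rotate j)
  iter-σ-B zero    j = refl
  iter-σ-B (suc k) j = trans (cong σ (iter-σ-B k j)) (σ-B _)

  σ-hasOrder : (∀ {d} → suc p′ ∣ d → suc q′ ∣ d → suc p′ * suc q′ ∣ d) → HasOrder σ (suc p′ * suc q′)
  σ-hasOrder lcm-divides = s≤s z≤n , σ↺ , minimal
    where
    σ↺ : iter (suc p′ * suc q′) σ ≗ id
    σ↺ x with view x
    ... | in-A i refl _ = trans (iter-σ-A (suc p′ * suc q′) i)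
      (cong A (trans (cong (λ t → iter t rotate i) (*-comm (suc p′) (suc q′))) (iter-rotate-period (suc q′) i)))
    ... | in-B j refl _ = trans (iter-σ-B (suc p′ * suc q′) j) (cong B (iter-rotate-period (suc p′) j))
    ... | fixed _ _ σ≡  = iter-fixedPoint σ (suc p′ * suc q′) σ≡
    minimal : ∀ d → 0 < d → d < suc p′ * suc q′ → ¬ (iter d σ ≗ id)
    minimal d 0<d d<pq σᵈ≗id = <⇒≱ d<pq (∣⇒≤ ⦃ >-nonZero 0<d ⦄ (lcm-divides
      (iter-rotate-zero d (A-injective (trans (sym (iter-σ-A d zero)) (σᵈ≗id (A zero)))))
      (iter-rotate-zero d (B-injective (trans (sym (iter-σ-B d zero)) (σᵈ≗id (B zero)))))))

module _ {n} {R : Rel (Fin n) 0ℓ} (R? : Decidable R) (isEq : IsEquivalence R) where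
  open IsEquivalence isEq using () renaming (refl to ~-refl; sym to ~-sym; trans to ~-trans)

  ElementOfOrder : ℕ → Set
  ElementOfOrder k = ∃ λ σ → Injective _≡_ _≡_ σ × ClassPreserving R σ × HasOrder σ k

  module _ {p′ q′} (lcm-divides : ∀ {d} → suc p′ ∣ d → suc q′ ∣ d → suc p′ * suc q′ ∣ d)
           {a b} (A : Fin (suc p′) → Fin n) (B : Fin (suc q′) → Fin n)
           (A-injective : Injective _≡_ _≡_ A) (B-injective : Injective _≡_ _≡_ B) (A≢B : ∀ i j → A i ≢ B j)
           (a~A : ∀ i → R a (A i)) (b~B : ∀ j → R b (B j)) where
    open DoubleRotation A B A-injective B-injective A≢B

    doubleRotation-elementOfOrder : ElementOfOrder (suc p′ * suc q′)
    doubleRotation-elementOfOrder = σ , σ-injective , σ-preserving , σ-hasOrder lcm-divides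
      where
      σ-preserving : ClassPreserving R σ
      σ-preserving = σ-classPreserving {R} ~-refl
        (λ i → ~-trans (~-sym (a~A i)) (a~A (rotate i))) (λ j → ~-trans (~-sym (b~B j)) (b~B (rotate j)))

  cyclesFit⇒elementOfOrder : ∀ {p q} → Prime p → Prime q → p ≢ q → CyclesFit R? p q → ElementOfOrder (p * q)
  cyclesFit⇒elementOfOrder {zero} p-prime = ⊥-elim (¬prime[0] p-prime)
  cyclesFit⇒elementOfOrder {suc p′} {zero} _ q-prime = ⊥-elim (¬prime[0] q-prime)
  cyclesFit⇒elementOfOrder {suc p′} {suc q′} p-prime q-prime p≢q (inj₁ (z , p+q≤count))
    with ≤count⇒embedding (R? z) p+q≤count
  ... | g , g-injective , z~g = doubleRotation-elementOfOrder (distinctPrimes-∣⇒*∣ p-prime q-prime p≢q)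
          (g ∘ (_↑ˡ suc q′)) (g ∘ (suc p′ ↑ʳ_))
          (↑ˡ-injective (suc q′) _ _ ∘ g-injective) (↑ʳ-injective (suc p′) _ _ ∘ g-injective)
          (λ i j → ↑ˡ≢↑ʳ i j ∘ g-injective)
          (z~g ∘ (_↑ˡ suc q′)) (z~g ∘ (suc p′ ↑ʳ_))
  cyclesFit⇒elementOfOrder {suc p′} {suc q′} p-prime q-prime p≢q (inj₂ (x , y , x≁y , p≤count , q≤count))
    with ≤count⇒embedding (R? x) p≤count | ≤count⇒embedding (R? y) q≤count
  ... | A , A-injective , x~A | B , B-injective , y~B = doubleRotation-elementOfOrder (distinctPrimes-∣⇒*∣ p-prime q-prime p≢q)
          A B A-injective B-injective (λ i j Ai≡Bj → x≁y (~-trans (x~A i) (~-sym (subst (R y) (sym Ai≡Bj) (y~B j)))))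
          x~A y~B

-- Structural equivalence

module _ {n} (Γ : Graph n) where

  isAut-cong : ∀ {σ τ} → IsAut Γ σ → σ ≗ τ → IsAut Γ τ
  isAut-cong {σ} {τ} σ-aut σ≗τ i j = subst₂ (λ x y → adj Γ x y ≡ adj Γ i j) (σ≗τ i) (σ≗τ j) (σ-aut i j)

  isAut-∘ : ∀ {σ τ} → IsAut Γ σ → IsAut Γ τ → IsAut Γ (σ ∘ τ)
  isAut-∘ {σ} {τ} σ-aut τ-aut i j = trans (σ-aut (τ i) (τ j)) (τ-aut i j)

  strEq-isEquivalence : IsEquivalence (StrEq Γ)
  strEq-isEquivalence = record { refl = strEq-refl ; sym = strEq-sym ; trans = strEq-trans }
    where
    strEq-refl : ∀ {u} → StrEq Γ u u
    strEq-refl {u} = isAut-cong {id} (λ _ _ → refl) (sym ∘ swap-self u)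
    strEq-sym : ∀ {u v} → StrEq Γ u v → StrEq Γ v u
    strEq-sym {u} {v} u~v = isAut-cong u~v (sym ∘ swap-comm u v)
    strEq-trans : ∀ {u v w} → StrEq Γ u v → StrEq Γ v w → StrEq Γ u w
    strEq-trans {u} {v} {w} u~v v~w with u ≟ᶠ v | v ≟ᶠ w | u ≟ᶠ w
    ... | yes refl | _        | _        = v~w
    ... | no _     | yes refl | _        = u~v
    ... | no _     | no _     | yes refl = strEq-refl
    ... | no u≢v   | no v≢w   | no u≢w   = isAut-cong (isAut-∘ u~v (isAut-∘ v~w u~v)) (swap-conjugate u≢v v≢w u≢w)

  classSize≡count : ∀ u → classSize Γ u ≡ count (strEq? Γ u)
  classSize≡count u = length-filter-tabulate (strEq? Γ u) id

  ≤count⇒≤classSize : ∀ {k v} → k ≤ count (strEq? Γ v) → k ≤ classSize Γ v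
  ≤count⇒≤classSize {v = v} = subst (_ ≤_) (sym (classSize≡count v))

  ≤classSize⇒≤count : ∀ {k v} → k ≤ classSize Γ v → k ≤ count (strEq? Γ v)
  ≤classSize⇒≤count {v = v} = subst (_ ≤_) (classSize≡count v)

  classSize-cong : ∀ {u v} → StrEq Γ u v → classSize Γ u ≡ classSize Γ v
  classSize-cong {u} {v} u~v = trans (classSize≡count u)
    (trans (count-class-cong (strEq? Γ) strEq-isEquivalence u~v) (sym (classSize≡count v)))

  private
    open YoungEnumeration (enumerateYoung (strEq? Γ) strEq-isEquivalence)

    sep⇒injective : ∀ {σ} → InSEP Γ σ → Injective _≡_ _≡_ σ
    sep⇒injective = productOfSwaps⇒injective

    sep⇒classPreserving : ∀ {σ} → InSEP Γ σ → ClassPreserving (StrEq Γ) σ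
    sep⇒classPreserving = productOfSwaps⇒classPreserving strEq-isEquivalence

  sepCardinality : ℕ
  sepCardinality = youngOrder (strEq? Γ)

  sepOrder : SEPOrder Γ sepCardinality
  sepOrder = perm , perm-product , perm-distinct ,
             λ σ σ∈SEP → perm-complete σ (sep⇒injective σ∈SEP) (sep⇒classPreserving σ∈SEP)

  prime∣sepCardinality⇔ : ∀ {p} → Prime p → p ∣ sepCardinality ⇔ ∃ λ v → p ≤ classSize Γ v
  prime∣sepCardinality⇔ p-prime = mk⇔
    (λ p∣m → let v , p≤count = prime∣youngOrder⇒ (strEq? Γ) strEq-isEquivalence p-prime p∣m
             in v , ≤count⇒≤classSize p≤count)
    (λ (v , p≤size) → ∣youngOrder (strEq? Γ) strEq-isEquivalence v (prime⇒>0 p-prime) (≤classSize⇒≤count p≤size))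

  sepHasElemOfOrder⇔ : ∀ {p q} → Prime p → Prime q → p ≢ q →
                       SEPHasElemOfOrder Γ (p * q) ⇔ CyclesFit (strEq? Γ) p q
  sepHasElemOfOrder⇔ p-prime q-prime p≢q = mk⇔
    (λ (σ , σ∈SEP , σ-order) → hasOrder⇒cyclesFit (strEq? Γ) strEq-isEquivalence
       (sep⇒injective σ∈SEP) (sep⇒classPreserving σ∈SEP) p-prime q-prime p≢q σ-order)
    (λ fit → let σ , σ-injective , σ-preserving , σ-order =
                   cyclesFit⇒elementOfOrder (strEq? Γ) strEq-isEquivalence p-prime q-prime p≢q fit
                 i , σ≗i = perm-complete σ σ-injective σ-preserving
                 ts , ts~ , i≗ts = perm-product i
             in σ , (ts , ts~ , λ x → trans (σ≗i x) (i≗ts x)) , σ-order)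

  prime∣sepCardinality⇔≤largest : ∀ {u} → (∀ v → classSize Γ v ≤ classSize Γ u) →
                                  ∀ {p} → Prime p → p ∣ sepCardinality ⇔ p ≤ classSize Γ u
  prime∣sepCardinality⇔≤largest {u} largest p-prime = mk⇔
    (λ p∣m → let v , p≤v = Equivalence.to (prime∣sepCardinality⇔ p-prime) p∣m in ≤-trans p≤v (largest v))
    (λ p≤u → Equivalence.from (prime∣sepCardinality⇔ p-prime) (u , p≤u))

  module _ {u₀} (u₀~ : ∀ v → StrEq Γ u₀ v) where

    oneClass-largest : ∀ v → classSize Γ v ≤ classSize Γ u₀
    oneClass-largest v = ≤-reflexive (sym (classSize-cong (u₀~ v)))

    oneClass-sepHasElemOfOrder⇔ : ∀ {p q} → Prime p → Prime q → p ≢ q →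
                                  SEPHasElemOfOrder Γ (p * q) ⇔ p + q ≤ classSize Γ u₀
    oneClass-sepHasElemOfOrder⇔ p-prime q-prime p≢q = mk⇔
      (fits⇒ ∘ Equivalence.to (sepHasElemOfOrder⇔ p-prime q-prime p≢q))
      (λ p+q≤u₀ → Equivalence.from (sepHasElemOfOrder⇔ p-prime q-prime p≢q) (inj₁ (u₀ , ≤classSize⇒≤count p+q≤u₀)))
      where
      open IsEquivalence strEq-isEquivalence using () renaming (sym to ~-sym; trans to ~-trans)
      fits⇒ : ∀ {p q} → CyclesFit (strEq? Γ) p q → p + q ≤ classSize Γ u₀
      fits⇒ (inj₁ (z , p+q≤z))            = ≤-trans (≤count⇒≤classSize p+q≤z) (oneClass-largest z)
      fits⇒ (inj₂ (x , y , x≁y , _ , _)) = ⊥-elim (x≁y (~-trans (~-sym (u₀~ x)) (u₀~ y)))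

  module _ {u₁ w} (largest : ∀ v → classSize Γ v ≤ classSize Γ u₁) (u₁≁w : ¬ StrEq Γ u₁ w)
           (second : ∀ v → ¬ StrEq Γ u₁ v → classSize Γ v ≤ classSize Γ w) where

    twoClasses-sepHasElemOfOrder⇔ : ∀ {p q} → Prime p → Prime q → q < p →
                                    SEPHasElemOfOrder Γ (p * q) ⇔
                                    (p + q ≤ classSize Γ u₁ ⊎ (p ≤ classSize Γ u₁ × q ≤ classSize Γ w))
    twoClasses-sepHasElemOfOrder⇔ {p} {q} p-prime q-prime q<p = mk⇔
      (fits⇒ ∘ Equivalence.to (sepHasElemOfOrder⇔ p-prime q-prime p≢q))
      (Equivalence.from (sepHasElemOfOrder⇔ p-prime q-prime p≢q) ∘ ⇒fits)
      where
      open IsEquivalence strEq-isEquivalence using () renaming (sym to ~-sym; trans to ~-trans)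
      p≢q : p ≢ q
      p≢q refl = <-irrefl refl q<p
      -- One of the two classes differs from that of u₁, and its cycle has length at least q.
      q≤w : ∀ {x y} → ¬ StrEq Γ x y → p ≤ classSize Γ x → q ≤ classSize Γ y → q ≤ classSize Γ w
      q≤w {x} {y} x≁y p≤x q≤y with strEq? Γ u₁ x
      ... | yes u₁~x = ≤-trans q≤y (second y (λ u₁~y → x≁y (~-trans (~-sym u₁~x) u₁~y)))
      ... | no u₁≁x  = ≤-trans (<⇒≤ q<p) (≤-trans p≤x (second x u₁≁x))
      fits⇒ : CyclesFit (strEq? Γ) p q → p + q ≤ classSize Γ u₁ ⊎ (p ≤ classSize Γ u₁ × q ≤ classSize Γ w)
      fits⇒ (inj₁ (z , p+q≤z)) = inj₁ (≤-trans (≤count⇒≤classSize p+q≤z) (largest z))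
      fits⇒ (inj₂ (x , y , x≁y , p≤x , q≤y)) =
        inj₂ (≤-trans (≤count⇒≤classSize p≤x) (largest x) , q≤w x≁y (≤count⇒≤classSize p≤x) (≤count⇒≤classSize q≤y))
      ⇒fits : p + q ≤ classSize Γ u₁ ⊎ (p ≤ classSize Γ u₁ × q ≤ classSize Γ w) → CyclesFit (strEq? Γ) p q
      ⇒fits (inj₁ p+q≤u₁)         = inj₁ (u₁ , ≤classSize⇒≤count p+q≤u₁)
      ⇒fits (inj₂ (p≤u₁ , q≤w′)) = inj₂ (u₁ , w , u₁≁w , ≤classSize⇒≤count p≤u₁ , ≤classSize⇒≤count q≤w′)

theorem3p1 : ∀ {n} (Γ : Graph n) →
    ((u₀ : Fin n) → (∀ v → StrEq Γ u₀ v) →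
      Σ ℕ λ m → SEPOrder Γ m ×
        (∀ p → Prime p → (p ∣ m ⇔ p ≤ classSize Γ u₀)) ×
        (∀ p q → Prime p → Prime q → p ≢ q → p ∣ m → q ∣ m →
          (SEPHasElemOfOrder Γ (p * q) ⇔ p + q ≤ classSize Γ u₀)))
    ×
    ((u₁ w : Fin n) → (∀ v → classSize Γ v ≤ classSize Γ u₁) →
      ¬ StrEq Γ u₁ w → (∀ v → ¬ StrEq Γ u₁ v → classSize Γ v ≤ classSize Γ w) →
      Σ ℕ λ m → SEPOrder Γ m ×
        (∀ p → Prime p → (p ∣ m ⇔ p ≤ classSize Γ u₁)) ×
        (∀ p q → Prime p → Prime q → q < p → p ∣ m → q ∣ m →
          (SEPHasElemOfOrder Γ (p * q) ⇔
            (p + q ≤ classSize Γ u₁ ⊎ (p ≤ classSize Γ u₁ × q ≤ classSize Γ w)))))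
theorem3p1 Γ =
  (λ u₀ u₀~ → sepCardinality Γ , sepOrder Γ ,
     (λ p → prime∣sepCardinality⇔≤largest Γ (oneClass-largest Γ u₀~)) ,
     (λ p q p-prime q-prime p≢q _ _ → oneClass-sepHasElemOfOrder⇔ Γ u₀~ p-prime q-prime p≢q)) ,
  (λ u₁ w largest u₁≁w second → sepCardinality Γ , sepOrder Γ ,
     (λ p → prime∣sepCardinality⇔≤largest Γ largest) ,
     (λ p q p-prime q-prime q<p _ _ → twoClasses-sepHasElemOfOrder⇔ Γ largest u₁≁w second p-prime q-prime q<p))
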